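{- Any two assorted central terms of the same type are equal.
   Context: Formulae are built from an infinite set of propositional letters and a constant $I$ using binary connectives $\otimes$ and $\to$. An $\alpha$-formula is a formula considered up to strict associativity of $\otimes$ and strict unitality of $I$ ($A\otimes(B\otimes C)=(A\otimes B)\otimes C$, $A\otimes I=I\otimes A=A$, also inside subformulae). An $\alpha$-formula is prime if it is not of the form $A\otimes B$ with $A,B$ both different from $I$; every $\alpha$-formula is uniquely $A_1\otimes\dots\otimes A_n$ with $A_i$ prime, its prime factors. An $\alpha$-formula is constant if it contains no letters; it is assorted if all its non-constant prime factors are mutually distinct. Terms with types $f\colon A\vdash B$: primitive $\mathbf 1_A\colon A\vdash A$, $c_{B,A}\colon B\otimes A\vdash A\otimes B$, $\eta_{A,B}\colon B\vdash A\to(A\otimes B)$, $\varepsilon_{A,B}\colon A\otimes(A\to B)\vdash B$; closed under $g\circ f$, $f_1\otimes f_2$, and $A\to f\colon A\to B_1\vdash A\to B_2$ (for $f\colon B_1\vdash B_2$); strictly $f\otimes(g\otimes h)=(f\otimes g)\otimes h$, $f\otimes\mathbf 1_I=\mathbf 1_I\otimes f=f$. Equality of terms is the smallest congruence (only between terms of the same type) containing: $g\circ\mathbf 1_A=g$, $\mathbf 1_A\circ f=f$; $h\circ(g\circ f)=(h\circ g)\circ f$; $\mathbf 1_A\otimes\mathbf 1_B=\mathbf 1_{A\otimes B}$; $(g_1\otimes g_2)\circ(f_1\otimes f_2)=(g_1\circ f_1)\otimes(g_2\circ f_2)$; $c_{A',B'}\circ(f\otimes g)=(g\otimes f)\circ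 c_{A,B}$ ($f\colon A\vdash A'$, $g\colon B\vdash B'$); $c_{B,A}\circ c_{A,B}=\mathbf 1_{A\otimes B}$; $c_{A\otimes B,C}=(c_{A,C}\otimes\mathbf 1_B)\circ(\mathbf 1_A\otimes c_{B,C})$; $A\to(g\circ f)=(A\to g)\circ(A\to f)$; $\eta_{A,B'}\circ f=(A\to(\mathbf 1_A\otimes f))\circ\eta_{A,B}$; $A\to\mathbf 1_B=\mathbf 1_{A\to B}$; $\varepsilon_{A,B'}\circ(\mathbf 1_A\otimes(A\to f))=f\circ\varepsilon_{A,B}$; $\varepsilon_{A,A\otimes B}\circ(\mathbf 1_A\otimes\eta_{A,B})=\mathbf 1_{A\otimes B}$; $(A\to\varepsilon_{A,B})\circ\eta_{A,A\to B}=\mathbf 1_{A\to B}$. A term is central if it contains no $\eta$, no $\varepsilon$ and no use of the operation $A\to(\cdot)$. A central term $f\colon A\vdash B$ is assorted if $A$ (equivalently $B$) is assorted. -}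

module Defs where

open import Data.Nat using (ℕ)
open import Data.Fin using (Fin)
open import Data.List using (List; []; _∷_; _++_; length; lookup)
open import Data.List.Relation.Unary.All using (All)
open import Relation.Binary.PropositionalEquality using (_≡_; _≢_)

-- An α-formula is represented by its (unique) list of prime factors:
--   I        is  []
--   A ⊗ B    is  A ++ B          (strict associativity / unitality built in)
-- A prime α-formula is a propositional letter (letters = ℕ, an infinite set)
-- or an implication A ⇒ B between α-formulae.

data Prime : Set where
  var : ℕ → Prime
  _⇒_ : List Prime → List Prime → Prime

Form : Set
Form = List Prime

I : Form
I = []

_⊗ᶠ_ : Form → Form → Form
A ⊗ᶠ B = A ++ B

infixr 6 _⊗ᶠ_

_⇒ᶠ_ : Form → Form → Form
A ⇒ᶠ B = (A ⇒ B) ∷ []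

data ConstP : Prime → Set where
  imp : {A B : Form} → All ConstP A → All ConstP B → ConstP (A ⇒ B)

Constant : Form → Set
Constant A = All ConstP A

Assorted : Form → Set
Assorted A = (i j : Fin (length A)) → i ≢ j →
             lookup A i ≡ lookup A j → ConstP (lookup A i)

data Tm : Set where
  id   : Form → Tm
  c    : Form → Form → Tm
  η    : Form → Form → Tm
  ε    : Form → Form → Tm
  _∘_  : Tm → Tm → Tm
  _⊗_  : Tm → Tm → Tm
  _⇒ₜ_ : Form → Tm → Tm

infixr 9 _∘_
infixr 7 _⊗_

infix 4 _∶_⊢_
data _∶_⊢_ : Tm → Form → Form → Set where
  id-t : (A : Form) → id A ∶ A ⊢ A
  c-t  : (A B : Form) → c A B ∶ A ⊗ᶠ B ⊢ B ⊗ᶠ A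
  η-t  : (A B : Form) → η A B ∶ B ⊢ (A ⇒ᶠ (A ⊗ᶠ B))
  ε-t  : (A B : Form) → ε A B ∶ A ⊗ᶠ (A ⇒ᶠ B) ⊢ B
  ∘-t  : {f g : Tm} {A B C : Form} → f ∶ A ⊢ B → g ∶ B ⊢ C → (g ∘ f) ∶ A ⊢ C
  ⊗-t  : {f g : Tm} {A B C D : Form} → f ∶ A ⊢ B → g ∶ C ⊢ D →
         (f ⊗ g) ∶ A ⊗ᶠ C ⊢ B ⊗ᶠ D
  ⇒-t  : {f : Tm} (X : Form) {B₁ B₂ : Form} → f ∶ B₁ ⊢ B₂ →
         (X ⇒ₜ f) ∶ (X ⇒ᶠ B₁) ⊢ (X ⇒ᶠ B₂)

-- Equality of terms  f ≈ g ∶ A ⊢ B : the smallest congruence (between terms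
-- of the same type) containing the listed equations, together with the strict
-- identifications f ⊗ (g ⊗ h) = (f ⊗ g) ⊗ h and f ⊗ 1_I = 1_I ⊗ f = f.
infix 4 _≈_∶_⊢_
data _≈_∶_⊢_ : Tm → Tm → Form → Form → Set where
  ≈-refl  : {f : Tm} {A B : Form} → f ∶ A ⊢ B → f ≈ f ∶ A ⊢ B
  ≈-sym   : {f g : Tm} {A B : Form} → f ≈ g ∶ A ⊢ B → g ≈ f ∶ A ⊢ B
  ≈-trans : {f g h : Tm} {A B : Form} →
            f ≈ g ∶ A ⊢ B → g ≈ h ∶ A ⊢ B → f ≈ h ∶ A ⊢ B
  ∘-cong  : {f f' g g' : Tm} {A B C : Form} →
            f ≈ f' ∶ A ⊢ B → g ≈ g' ∶ B ⊢ C → (g ∘ f) ≈ (g' ∘ f') ∶ A ⊢ C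
  ⊗-cong  : {f f' g g' : Tm} {A B C D : Form} →
            f ≈ f' ∶ A ⊢ B → g ≈ g' ∶ C ⊢ D →
            (f ⊗ g) ≈ (f' ⊗ g') ∶ A ⊗ᶠ C ⊢ B ⊗ᶠ D
  ⇒-cong  : {f f' : Tm} (X : Form) {B₁ B₂ : Form} → f ≈ f' ∶ B₁ ⊢ B₂ →
            (X ⇒ₜ f) ≈ (X ⇒ₜ f') ∶ (X ⇒ᶠ B₁) ⊢ (X ⇒ᶠ B₂)
  ⊗-assoc : {f g h : Tm} {A A' B B' C C' : Form} →
            f ∶ A ⊢ A' → g ∶ B ⊢ B' → h ∶ C ⊢ C' →
            (f ⊗ (g ⊗ h)) ≈ ((f ⊗ g) ⊗ h) ∶ A ⊗ᶠ B ⊗ᶠ C ⊢ A' ⊗ᶠ B' ⊗ᶠ C'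
  ⊗-unitʳ : {f : Tm} {A B : Form} → f ∶ A ⊢ B → (f ⊗ id I) ≈ f ∶ A ⊢ B
  ⊗-unitˡ : {f : Tm} {A B : Form} → f ∶ A ⊢ B → (id I ⊗ f) ≈ f ∶ A ⊢ B
  idʳ     : {g : Tm} {A B : Form} → g ∶ A ⊢ B → (g ∘ id A) ≈ g ∶ A ⊢ B
  idˡ     : {f : Tm} {A B : Form} → f ∶ A ⊢ B → (id B ∘ f) ≈ f ∶ A ⊢ B
  ∘-assoc : {f g h : Tm} {A B C D : Form} →
            f ∶ A ⊢ B → g ∶ B ⊢ C → h ∶ C ⊢ D →
            (h ∘ (g ∘ f)) ≈ ((h ∘ g) ∘ f) ∶ A ⊢ D
  id⊗id   : (A B : Form) → (id A ⊗ id B) ≈ id (A ⊗ᶠ B) ∶ A ⊗ᶠ B ⊢ A ⊗ᶠ B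
  interchange : {f₁ f₂ g₁ g₂ : Tm} {A₁ A₂ B₁ B₂ C₁ C₂ : Form} →
            f₁ ∶ A₁ ⊢ B₁ → g₁ ∶ B₁ ⊢ C₁ → f₂ ∶ A₂ ⊢ B₂ → g₂ ∶ B₂ ⊢ C₂ →
            ((g₁ ⊗ g₂) ∘ (f₁ ⊗ f₂)) ≈ ((g₁ ∘ f₁) ⊗ (g₂ ∘ f₂))
              ∶ A₁ ⊗ᶠ A₂ ⊢ C₁ ⊗ᶠ C₂
  c-nat   : {f g : Tm} {A A' B B' : Form} → f ∶ A ⊢ A' → g ∶ B ⊢ B' →
            (c A' B' ∘ (f ⊗ g)) ≈ ((g ⊗ f) ∘ c A B) ∶ A ⊗ᶠ B ⊢ B' ⊗ᶠ A'
  c-inv   : (A B : Form) → (c B A ∘ c A B) ≈ id (A ⊗ᶠ B) ∶ A ⊗ᶠ B ⊢ A ⊗ᶠ B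
  c-hex   : (A B C : Form) →
            c (A ⊗ᶠ B) C ≈ ((c A C ⊗ id B) ∘ (id A ⊗ c B C))
              ∶ (A ⊗ᶠ B) ⊗ᶠ C ⊢ C ⊗ᶠ (A ⊗ᶠ B)
  ⇒-comp  : {f g : Tm} (X : Form) {A B C : Form} → f ∶ A ⊢ B → g ∶ B ⊢ C →
            (X ⇒ₜ (g ∘ f)) ≈ ((X ⇒ₜ g) ∘ (X ⇒ₜ f)) ∶ (X ⇒ᶠ A) ⊢ (X ⇒ᶠ C)
  η-nat   : {f : Tm} (X : Form) {B B' : Form} → f ∶ B ⊢ B' →
            (η X B' ∘ f) ≈ ((X ⇒ₜ (id X ⊗ f)) ∘ η X B)
              ∶ B ⊢ (X ⇒ᶠ (X ⊗ᶠ B'))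
  ⇒-id    : (X B : Form) → (X ⇒ₜ id B) ≈ id (X ⇒ᶠ B) ∶ (X ⇒ᶠ B) ⊢ (X ⇒ᶠ B)
  ε-nat   : {f : Tm} (X : Form) {B B' : Form} → f ∶ B ⊢ B' →
            (ε X B' ∘ (id X ⊗ (X ⇒ₜ f))) ≈ (f ∘ ε X B)
              ∶ X ⊗ᶠ (X ⇒ᶠ B) ⊢ B'
  triangle₁ : (X B : Form) →
            (ε X (X ⊗ᶠ B) ∘ (id X ⊗ η X B)) ≈ id (X ⊗ᶠ B) ∶ X ⊗ᶠ B ⊢ X ⊗ᶠ B
  triangle₂ : (X B : Form) →
            ((X ⇒ₜ ε X B) ∘ η X (X ⇒ᶠ B)) ≈ id (X ⇒ᶠ B)
              ∶ (X ⇒ᶠ B) ⊢ (X ⇒ᶠ B)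

data Central : Tm → Set where
  id-c : (A : Form) → Central (id A)
  c-c  : (A B : Form) → Central (c A B)
  ∘-c  : {f g : Tm} → Central g → Central f → Central (g ∘ f)
  ⊗-c  : {f g : Tm} → Central f → Central g → Central (f ⊗ g)

{-# OPTIONS --safe #-}
-- Constant formulae are retracts of I: for A ⇒ B this is built from η, ε and
-- the triangle identity.  Naturality of the symmetry then makes c_{P,P} the
-- identity for every constant prime P.
--
-- For the rest, a central map s : A ⊢ B is compared with the canonical map
-- A ⊢ C that inserts the prime factors of A one at a time at their first
-- occurrence in C.  Canonical maps absorb s (composing one with s gives the
-- canonical map again) as soon as A has no repeated non-constant factor.  It
-- suffices to check this for the generators of central maps in arbitrary
-- context, which reduces it to a transposition of two adjacent primes p, q.
-- If p = q, then p is constant and the transposition is the identity; if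
-- p ≠ q, it amounts to inserting p and q in either order, and the two orders
-- agree by the Yang–Baxter equation.  For assorted A, taking C = B shows that
-- every central map A ⊢ B is the canonical one.
module Submission where

open import Defs
open import Data.Nat using (ℕ; suc; _+_; _≤_; _<_; z≤n; s≤s)
import Data.Nat.Properties as ℕ
open import Data.Fin using (Fin) renaming (zero to fzero; suc to fsuc)
import Data.Fin.Properties as Fin
open import Data.List using (List; []; _∷_; [_]; _++_; length; lookup)
open import Data.List.Properties using (++-assoc; ++-identityʳ)
open import Data.List.Relation.Unary.All using ([]; _∷_)
open import Data.Product using (Σ; _,_)
open import Data.Sum using (_⊎_; inj₁; inj₂)
open import Data.Empty using (⊥-elim)
open import Relation.Nullary using (Dec; yes; no)
open import Relation.Nullary.Decidable using (map′)
open import Relation.Binary.Definitions using (DecidableEquality)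
open import Relation.Binary.PropositionalEquality
  using (_≡_; _≢_; refl; sym; trans; cong; subst; subst₂; module ≡-Reasoning)

infix 4 _≟ₚ_ _≟ᶠ_

mutual
  _≟ₚ_ : DecidableEquality Prime
  var m ≟ₚ var n = map′ (cong var) (λ { refl → refl }) (m ℕ.≟ n)
  var _ ≟ₚ (_ ⇒ _) = no λ ()
  (_ ⇒ _) ≟ₚ var _ = no λ ()
  (A ⇒ B) ≟ₚ (C ⇒ D) with A ≟ᶠ C | B ≟ᶠ D
  ... | yes refl | yes refl = yes refl
  ... | no A≢C   | _        = no λ { refl → A≢C refl }
  ... | yes _    | no B≢D   = no λ { refl → B≢D refl }

  _≟ᶠ_ : DecidableEquality Form
  [] ≟ᶠ [] = yes refl
  [] ≟ᶠ (_ ∷ _) = no λ ()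
  (_ ∷ _) ≟ᶠ [] = no λ ()
  (x ∷ A) ≟ᶠ (y ∷ B) with x ≟ₚ y | A ≟ᶠ B
  ... | yes refl | yes refl = yes refl
  ... | no x≢y   | _        = no λ { refl → x≢y refl }
  ... | yes _    | no A≢B   = no λ { refl → A≢B refl }

count : Prime → Form → ℕ
count p [] = 0
count p (x ∷ A) with p ≟ₚ x
... | yes _ = suc (count p A)
... | no  _ = count p A

infix 4 _∈ᶠ_
_∈ᶠ_ : Prime → Form → Set
a ∈ᶠ C = 0 < count a C

remove : Prime → Form → Form
remove a [] = []
remove a (x ∷ C) with a ≟ₚ x
... | yes _ = C
... | no  _ = x ∷ remove a C

SameFactors : Form → Form → Set
SameFactors A C = ∀ p → count p A ≡ count p C

count-here : ∀ p A → count p (p ∷ A) ≡ suc (count p A)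
count-here p A with p ≟ₚ p
... | yes _  = refl
... | no p≢p = ⊥-elim (p≢p refl)

count-there : ∀ {p x} A → p ≢ x → count p (x ∷ A) ≡ count p A
count-there {p} {x} A p≢x with p ≟ₚ x
... | yes p≡x = ⊥-elim (p≢x p≡x)
... | no  _   = refl

count-++ : ∀ p A B → count p (A ++ B) ≡ count p A + count p B
count-++ p [] B = refl
count-++ p (x ∷ A) B with p ≟ₚ x
... | yes _ = cong suc (count-++ p A B)
... | no  _ = count-++ p A B

∈ᶠ-here : ∀ a C → a ∈ᶠ a ∷ C
∈ᶠ-here a C = subst (0 <_) (sym (count-here a C)) (s≤s z≤n)

∈ᶠ-there : ∀ {a x} C → a ≢ x → a ∈ᶠ x ∷ C → a ∈ᶠ C
∈ᶠ-there C a≢x = subst (0 <_) (count-there C a≢x)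

remove-here : ∀ a C → remove a (a ∷ C) ≡ C
remove-here a C with a ≟ₚ a
... | yes _  = refl
... | no a≢a = ⊥-elim (a≢a refl)

remove-there : ∀ {a x} C → a ≢ x → remove a (x ∷ C) ≡ x ∷ remove a C
remove-there {a} {x} C a≢x with a ≟ₚ x
... | yes a≡x = ⊥-elim (a≢x a≡x)
... | no  _   = refl

count-remove-≢ : ∀ {p a} C → p ≢ a → count p (remove a C) ≡ count p C
count-remove-≢ [] _ = refl
count-remove-≢ {p} {a} (x ∷ C) p≢a with a ≟ₚ x
... | yes refl = sym (count-there C p≢a)
... | no  a≢x  with p ≟ₚ x
...   | yes _ = cong suc (count-remove-≢ C p≢a)
...   | no  _ = count-remove-≢ C p≢a

count-remove-≡ : ∀ {a} C → a ∈ᶠ C → suc (count a (remove a C)) ≡ count a C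
count-remove-≡ [] ()
count-remove-≡ {a} (x ∷ C) a∈C with a ≟ₚ x
... | yes refl = refl
... | no  a≢x  = trans (cong suc (count-there (remove a C) a≢x)) (count-remove-≡ C a∈C)

remove-comm : ∀ {p q} C → p ≢ q → remove p (remove q C) ≡ remove q (remove p C)
remove-comm [] _ = refl
remove-comm {p} {q} (x ∷ C) p≢q = by-cases (p ≟ₚ x) (q ≟ₚ x)
  where
  open ≡-Reasoning
  by-cases : Dec (p ≡ x) → Dec (q ≡ x) →
             remove p (remove q (x ∷ C)) ≡ remove q (remove p (x ∷ C))
  by-cases (yes refl) (yes refl) = ⊥-elim (p≢q refl)
  by-cases (yes refl) (no q≢x) = begin
    remove p (remove q (p ∷ C)) ≡⟨ cong (remove p) (remove-there C q≢x) ⟩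
    remove p (p ∷ remove q C)   ≡⟨ remove-here p (remove q C) ⟩
    remove q C                  ≡⟨ cong (remove q) (remove-here p C) ⟨
    remove q (remove p (p ∷ C)) ∎
  by-cases (no p≢x) (yes refl) = begin
    remove p (remove q (q ∷ C)) ≡⟨ cong (remove p) (remove-here q C) ⟩
    remove p C                  ≡⟨ remove-here q (remove p C) ⟨
    remove q (q ∷ remove p C)   ≡⟨ cong (remove q) (remove-there C p≢x) ⟨
    remove q (remove p (q ∷ C)) ∎
  by-cases (no p≢x) (no q≢x) = begin
    remove p (remove q (x ∷ C)) ≡⟨ cong (remove p) (remove-there C q≢x) ⟩
    remove p (x ∷ remove q C)   ≡⟨ remove-there (remove q C) p≢x ⟩
    x ∷ remove p (remove q C)   ≡⟨ cong (x ∷_) (remove-comm C p≢q) ⟩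
    x ∷ remove q (remove p C)   ≡⟨ remove-there (remove p C) q≢x ⟨
    remove q (x ∷ remove p C)   ≡⟨ cong (remove q) (remove-there C p≢x) ⟨
    remove q (remove p (x ∷ C)) ∎

∈ᶠ-head : ∀ {a A} C → SameFactors (a ∷ A) C → a ∈ᶠ C
∈ᶠ-head {a} {A} C A∼C = subst (0 <_) (trans (sym (count-here a A)) (A∼C a)) (s≤s z≤n)

SameFactors-tail : ∀ {a A} C → SameFactors (a ∷ A) C → SameFactors A (remove a C)
SameFactors-tail {a} {A} C aA∼C p with p ≟ₚ a
... | yes refl = ℕ.suc-injective (begin
      suc (count p A)            ≡⟨ count-here p A ⟨
      count p (p ∷ A)            ≡⟨ aA∼C p ⟩
      count p C                  ≡⟨ count-remove-≡ C (∈ᶠ-head C aA∼C) ⟨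
      suc (count p (remove p C)) ∎)
  where open ≡-Reasoning
... | no p≢a = trans (sym (count-there A p≢a))
                     (trans (aA∼C p) (sym (count-remove-≢ C p≢a)))

SameFactors-[] : ∀ C → SameFactors [] C → C ≡ []
SameFactors-[] [] _ = refl
SameFactors-[] (x ∷ C) []∼C with trans ([]∼C x) (count-here x C)
... | ()

SameFactors-whisker : ∀ X Z {A B} → SameFactors A B →
                      SameFactors (X ++ A ++ Z) (X ++ B ++ Z)
SameFactors-whisker X Z {A} {B} A∼B p = begin
  count p (X ++ A ++ Z)             ≡⟨ count-++ p X (A ++ Z) ⟩
  count p X + count p (A ++ Z)      ≡⟨ cong (count p X +_) (count-++ p A Z) ⟩
  count p X + (count p A + count p Z) ≡⟨ cong (λ n → count p X + (n + count p Z)) (A∼B p) ⟩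
  count p X + (count p B + count p Z) ≡⟨ cong (count p X +_) (count-++ p B Z) ⟨
  count p X + count p (B ++ Z)      ≡⟨ count-++ p X (B ++ Z) ⟨
  count p (X ++ B ++ Z)             ∎
  where open ≡-Reasoning

SameFactors-swap : ∀ A B → SameFactors (A ++ B) (B ++ A)
SameFactors-swap A B p = trans (count-++ p A B)
  (trans (ℕ.+-comm (count p A) (count p B)) (sym (count-++ p B A)))

CountAssorted : Form → Set
CountAssorted A = ∀ p → ConstP p ⊎ count p A ≤ 1

CountAssorted-resp : ∀ {A B} → SameFactors A B → CountAssorted A → CountAssorted B
CountAssorted-resp A∼B assorted p with assorted p
... | inj₁ constant = inj₁ constant
... | inj₂ count≤1  = inj₂ (subst (_≤ 1) (A∼B p) count≤1)

CountAssorted-repeated : ∀ {p} X Z → CountAssorted (X ++ p ∷ p ∷ Z) → ConstP p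
CountAssorted-repeated {p} X Z assorted with assorted p
... | inj₁ constant = constant
... | inj₂ count≤1  = ⊥-elim (ℕ.<-irrefl refl (ℕ.≤-trans 2≤count count≤1))
  where
  2≤count : 2 ≤ count p (X ++ p ∷ p ∷ Z)
  2≤count = subst (2 ≤_)
    (sym (trans (count-++ p X (p ∷ p ∷ Z))
                (cong (count p X +_) (trans (count-here p (p ∷ Z)) (cong suc (count-here p Z))))))
    (ℕ.≤-trans (s≤s (s≤s z≤n)) (ℕ.m≤n+m _ (count p X)))

Assorted-tail : ∀ {x A} → Assorted (x ∷ A) → Assorted A
Assorted-tail assorted i j i≢j = assorted (fsuc i) (fsuc j) (λ si≡sj → i≢j (Fin.suc-injective si≡sj))

∈ᶠ⇒lookup : ∀ {p} A → p ∈ᶠ A → Σ (Fin (length A)) (λ j → lookup A j ≡ p)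
∈ᶠ⇒lookup [] ()
∈ᶠ⇒lookup {p} (x ∷ A) p∈xA with p ≟ₚ x
... | yes p≡x = fzero , sym p≡x
... | no  _   with ∈ᶠ⇒lookup A p∈xA
...   | j , A[j]≡p = fsuc j , A[j]≡p

Assorted-repeated : ∀ {p} A → Assorted A → 2 ≤ count p A → ConstP p
Assorted-repeated [] _ ()
Assorted-repeated {p} (x ∷ A) assorted 2≤count with p ≟ₚ x
... | yes refl with ∈ᶠ⇒lookup A (ℕ.≤-pred 2≤count)
...   | j , A[j]≡p = assorted fzero (fsuc j) (λ ()) (sym A[j]≡p)
Assorted-repeated (x ∷ A) assorted 2≤count | no _ = Assorted-repeated A (Assorted-tail assorted) 2≤count

Assorted⇒CountAssorted : ∀ {A} → Assorted A → CountAssorted A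
Assorted⇒CountAssorted {A} assorted p with count p A ℕ.≤? 1
... | yes count≤1 = inj₂ count≤1
... | no  count≰1 = inj₁ (Assorted-repeated A assorted (ℕ.≰⇒> count≰1))

record Hom (A B : Form) : Set where
  constructor mk
  field
    tm : Tm
    ty : tm ∶ A ⊢ B
open Hom public

-- Equality of typed terms whose types agree only propositionally, which
-- absorbs the transports along ++-assoc and ++-identityʳ.
infix 4 _≋_
record _≋_ {A B A′ B′} (f : Hom A B) (g : Hom A′ B′) : Set where
  constructor ≋-intro
  field
    dom≡ : A ≡ A′
    cod≡ : B ≡ B′
    tm≈  : tm f ≈ tm g ∶ A ⊢ B

≋-refl : ∀ {A B} {f : Hom A B} → f ≋ f
≋-refl {f = f} = ≋-intro refl refl (≈-refl (ty f))

≋-sym : ∀ {A B A′ B′} {f : Hom A B} {g : Hom A′ B′} → f ≋ g → g ≋ f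
≋-sym (≋-intro refl refl f≈g) = ≋-intro refl refl (≈-sym f≈g)

≋-trans : ∀ {A B A′ B′ A″ B″} {f : Hom A B} {g : Hom A′ B′} {h : Hom A″ B″} →
          f ≋ g → g ≋ h → f ≋ h
≋-trans (≋-intro refl refl f≈g) (≋-intro refl refl g≈h) = ≋-intro refl refl (≈-trans f≈g g≈h)

≋⇒≈ : ∀ {A B} {f g : Hom A B} → f ≋ g → tm f ≈ tm g ∶ A ⊢ B
≋⇒≈ = _≋_.tm≈

≡⇒≋ : ∀ {A B A′ B′} {f : Hom A B} {g : Hom A′ B′} → A ≡ A′ → B ≡ B′ → tm f ≡ tm g → f ≋ g
≡⇒≋ {f = f} refl refl refl = ≋-intro refl refl (≈-refl (ty f))

module ≋-Reasoning where
  infix  1 begin_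
  infixr 2 _≋⟨_⟩_ _≋⟨_⟨_
  infix  3 _∎

  begin_ : ∀ {A B A′ B′} {f : Hom A B} {g : Hom A′ B′} → f ≋ g → f ≋ g
  begin p = p

  _≋⟨_⟩_ : ∀ {A B A′ B′ A″ B″} (f : Hom A B) {g : Hom A′ B′} {h : Hom A″ B″} →
           f ≋ g → g ≋ h → f ≋ h
  _ ≋⟨ p ⟩ q = ≋-trans p q

  _≋⟨_⟨_ : ∀ {A B A′ B′ A″ B″} (f : Hom A B) {g : Hom A′ B′} {h : Hom A″ B″} →
           g ≋ f → g ≋ h → f ≋ h
  _ ≋⟨ p ⟨ q = ≋-trans (≋-sym p) q

  _∎ : ∀ {A B} (f : Hom A B) → f ≋ f
  _ ∎ = ≋-refl

open ≋-Reasoning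

idH : ∀ A → Hom A A
idH A = mk (id A) (id-t A)

cH : ∀ A B → Hom (A ++ B) (B ++ A)
cH A B = mk (c A B) (c-t A B)

idH-cong : ∀ {A A′} → A ≡ A′ → idH A ≋ idH A′
idH-cong refl = ≋-refl

infixr 9 _∙_
_∙_ : ∀ {A B C} → Hom B C → Hom A B → Hom A C
g ∙ f = mk (tm g ∘ tm f) (∘-t (ty f) (ty g))

infixr 7 _⊠_
_⊠_ : ∀ {A B C D} → Hom A B → Hom C D → Hom (A ++ C) (B ++ D)
f ⊠ g = mk (tm f ⊗ tm g) (⊗-t (ty f) (ty g))

cast : ∀ {A B A′ B′} → A ≡ A′ → B ≡ B′ → Hom A B → Hom A′ B′
cast A≡A′ B≡B′ f = mk (tm f) (subst₂ (tm f ∶_⊢_) A≡A′ B≡B′ (ty f))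

cast-≋ : ∀ {A B A′ B′} (A≡A′ : A ≡ A′) (B≡B′ : B ≡ B′) (f : Hom A B) → cast A≡A′ B≡B′ f ≋ f
cast-≋ refl refl f = ≋-refl

∙-cong : ∀ {A B C A′ B′ C′} {f : Hom A B} {f′ : Hom A′ B′} {g : Hom B C} {g′ : Hom B′ C′} →
         g ≋ g′ → f ≋ f′ → g ∙ f ≋ g′ ∙ f′
∙-cong (≋-intro refl refl g≈g′) (≋-intro refl refl f≈f′) = ≋-intro refl refl (∘-cong f≈f′ g≈g′)

⊠-cong : ∀ {A B C D A′ B′ C′ D′} {f : Hom A B} {f′ : Hom A′ B′} {g : Hom C D} {g′ : Hom C′ D′} →
         f ≋ f′ → g ≋ g′ → f ⊠ g ≋ f′ ⊠ g′
⊠-cong (≋-intro refl refl f≈f′) (≋-intro refl refl g≈g′) = ≋-intro refl refl (⊗-cong f≈f′ g≈g′)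

identityˡ : ∀ {A B} (f : Hom A B) → idH B ∙ f ≋ f
identityˡ f = ≋-intro refl refl (idˡ (ty f))

identityʳ : ∀ {A B} (f : Hom A B) → f ∙ idH A ≋ f
identityʳ f = ≋-intro refl refl (idʳ (ty f))

assoc : ∀ {A B C D} (h : Hom C D) (g : Hom B C) (f : Hom A B) → (h ∙ g) ∙ f ≋ h ∙ (g ∙ f)
assoc h g f = ≋-intro refl refl (≈-sym (∘-assoc (ty f) (ty g) (ty h)))

⊠-interchange : ∀ {A₁ A₂ B₁ B₂ C₁ C₂} (g₁ : Hom B₁ C₁) (g₂ : Hom B₂ C₂)
                (f₁ : Hom A₁ B₁) (f₂ : Hom A₂ B₂) →
                (g₁ ⊠ g₂) ∙ (f₁ ⊠ f₂) ≋ (g₁ ∙ f₁) ⊠ (g₂ ∙ f₂)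
⊠-interchange g₁ g₂ f₁ f₂ = ≋-intro refl refl (interchange (ty f₁) (ty g₁) (ty f₂) (ty g₂))

idH-⊠ : ∀ A B → idH A ⊠ idH B ≋ idH (A ++ B)
idH-⊠ A B = ≋-intro refl refl (id⊗id A B)

⊠-assoc : ∀ {A A′ B B′ C C′} (f : Hom A A′) (g : Hom B B′) (h : Hom C C′) →
          f ⊠ (g ⊠ h) ≋ (f ⊠ g) ⊠ h
⊠-assoc {A} {A′} {B} {B′} {C} {C′} f g h =
  ≋-trans (≋-intro refl refl (⊗-assoc (ty f) (ty g) (ty h)))
          (cast-≋ (++-assoc A B C) (++-assoc A′ B′ C′) ((f ⊠ g) ⊠ h))

⊠-identityˡ : ∀ {A B} (f : Hom A B) → idH [] ⊠ f ≋ f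
⊠-identityˡ f = ≋-intro refl refl (⊗-unitˡ (ty f))

⊠-identityʳ : ∀ {A B} (f : Hom A B) → f ⊠ idH [] ≋ f
⊠-identityʳ {A} {B} f = ≋-intro (++-identityʳ A) (++-identityʳ B) (⊗-unitʳ (ty (cast A≡ B≡ f)))
  where
  A≡ = sym (++-identityʳ A)
  B≡ = sym (++-identityʳ B)

cH-natural : ∀ {A A′ B B′} (f : Hom A A′) (g : Hom B B′) → cH A′ B′ ∙ (f ⊠ g) ≋ (g ⊠ f) ∙ cH A B
cH-natural f g = ≋-intro refl refl (c-nat (ty f) (ty g))

cH-inverse : ∀ A B → cH B A ∙ cH A B ≋ idH (A ++ B)
cH-inverse A B = ≋-intro refl refl (c-inv A B)

cH-hexagon : ∀ A B C → cH (A ++ B) C ≋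
  cast refl (++-assoc C A B) (cH A C ⊠ idH B) ∙
  cast (sym (++-assoc A B C)) (sym (++-assoc A C B)) (idH A ⊠ cH B C)
cH-hexagon A B C = ≋-intro refl refl (c-hex A B C)

elimʳ : ∀ {A B C D} (f : Hom B C) {i : Hom A B} → i ≋ idH D → f ∙ i ≋ f
elimʳ f i≋id@(≋-intro refl refl _) = ≋-trans (∙-cong ≋-refl i≋id) (identityʳ f)

elimˡ : ∀ {A B C D} {i : Hom B C} (f : Hom A B) → i ≋ idH D → i ∙ f ≋ f
elimˡ f i≋id@(≋-intro refl refl _) = ≋-trans (∙-cong i≋id ≋-refl) (identityˡ f)

pullˡ : ∀ {A B C D C′} {h : Hom C D} {g : Hom B C} {k : Hom B C′} (f : Hom A B) →
        h ∙ g ≋ k → h ∙ (g ∙ f) ≋ k ∙ f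
pullˡ f hg≋k = ≋-trans (≋-sym (assoc _ _ f)) (∙-cong hg≋k ≋-refl)

pullʳ : ∀ {A B C D} {g : Hom B C} {f : Hom A B} {k : Hom A C} (h : Hom C D) →
        g ∙ f ≋ k → (h ∙ g) ∙ f ≋ h ∙ k
pullʳ h gf≋k = ≋-trans (assoc h _ _) (∙-cong ≋-refl gf≋k)

⊠-factorˡ : ∀ {A B C D} (f : Hom A B) (g : Hom C D) → f ⊠ g ≋ (f ⊠ idH D) ∙ (idH A ⊠ g)
⊠-factorˡ f g = ≋-sym (≋-trans (⊠-interchange f (idH _) (idH _) g) (⊠-cong (identityʳ f) (identityˡ g)))

⊠-factorʳ : ∀ {A B C D} (f : Hom A B) (g : Hom C D) → f ⊠ g ≋ (idH B ⊠ g) ∙ (f ⊠ idH C)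
⊠-factorʳ f g = ≋-sym (≋-trans (⊠-interchange (idH _) g f (idH _)) (⊠-cong (identityˡ f) (identityʳ g)))

⊠-slide : ∀ {A B C D} (f : Hom A B) (g : Hom C D) →
          (f ⊠ idH D) ∙ (idH A ⊠ g) ≋ (idH B ⊠ g) ∙ (f ⊠ idH C)
⊠-slide f g = ≋-trans (≋-sym (⊠-factorˡ f g)) (⊠-factorʳ f g)

id⊠-∙ : ∀ {X A B C} (g : Hom B C) (f : Hom A B) → idH X ⊠ (g ∙ f) ≋ (idH X ⊠ g) ∙ (idH X ⊠ f)
id⊠-∙ {X} g f = ≋-sym (≋-trans (⊠-interchange (idH X) g (idH X) f) (⊠-cong (identityˡ (idH X)) ≋-refl))

∙-⊠id : ∀ {Z A B C} (g : Hom B C) (f : Hom A B) → (g ∙ f) ⊠ idH Z ≋ (g ⊠ idH Z) ∙ (f ⊠ idH Z)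
∙-⊠id {Z} g f = ≋-sym (≋-trans (⊠-interchange g (idH Z) f (idH Z)) (⊠-cong ≋-refl (identityˡ (idH Z))))

⊠-inverse : ∀ {A B C D} {f : Hom A B} {f′ : Hom B A} {g : Hom C D} {g′ : Hom D C} →
            f′ ∙ f ≋ idH A → g′ ∙ g ≋ idH C → (f′ ⊠ g′) ∙ (f ⊠ g) ≋ idH (A ++ C)
⊠-inverse {A} {C = C} f′f≋id g′g≋id =
  ≋-trans (⊠-interchange _ _ _ _) (≋-trans (⊠-cong f′f≋id g′g≋id) (idH-⊠ A C))

idH-⊠-assoc : ∀ {A B} X Y (f : Hom A B) → idH X ⊠ idH Y ⊠ f ≋ idH (X ++ Y) ⊠ f
idH-⊠-assoc X Y f = ≋-trans (⊠-assoc _ _ _) (⊠-cong (idH-⊠ X Y) ≋-refl)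

-- The hexagon at A = B = I says that cH I C is idempotent; it is invertible.
cH-identityˡ : ∀ C → cH [] C ≋ idH C
cH-identityˡ C = begin
  k                          ≋⟨ cast-≋ C≡ refl k ⟨
  k′                         ≋⟨ identityʳ k′ ⟨
  k′ ∙ idH (C ++ [])         ≋⟨ ∙-cong ≋-refl (cH-inverse C []) ⟨
  k′ ∙ (k ∙ cH C [])         ≋⟨ pullˡ (cH C []) (≋-sym idempotent) ⟩
  k ∙ cH C []                ≋⟨ cH-inverse C [] ⟩
  idH (C ++ [])              ≋⟨ ≡⇒≋ (sym C≡) (sym C≡) (cong id (sym C≡)) ⟩
  idH C                      ∎
  where
  k = cH [] C
  C≡ = sym (++-identityʳ C)
  k′ : Hom (C ++ []) (C ++ [])
  k′ = cast C≡ refl k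
  idempotent : k ≋ k′ ∙ k
  idempotent = ≋-trans (cH-hexagon [] [] C)
    (∙-cong (≋-trans (cast-≋ _ _ _) (≋-trans (⊠-identityʳ k) (≋-sym (cast-≋ _ _ _))))
            (⊠-identityˡ k))

εH : ∀ A B → Hom (A ++ A ⇒ᶠ B) B
εH A B = mk (ε A B) (ε-t A B)

ηH : ∀ A B → Hom B (A ⇒ᶠ (A ++ B))
ηH A B = mk (η A B) (η-t A B)

⇒H : ∀ X {B₁ B₂} → Hom B₁ B₂ → Hom (X ⇒ᶠ B₁) (X ⇒ᶠ B₂)
⇒H X f = mk (X ⇒ₜ tm f) (⇒-t X (ty f))

⇒H-∙ : ∀ X {A B C} (g : Hom B C) (f : Hom A B) → ⇒H X (g ∙ f) ≋ ⇒H X g ∙ ⇒H X f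
⇒H-∙ X g f = ≋-intro refl refl (⇒-comp X (ty f) (ty g))

⇒H-cong : ∀ X {A B A′ B′} {f : Hom A B} {f′ : Hom A′ B′} → f ≋ f′ → ⇒H X f ≋ ⇒H X f′
⇒H-cong X (≋-intro refl refl f≈f′) = ≋-intro refl refl (⇒-cong X f≈f′)

ηH-natural : ∀ X {B B′} (f : Hom B B′) → ηH X B′ ∙ f ≋ ⇒H X (idH X ⊠ f) ∙ ηH X B
ηH-natural X f = ≋-intro refl refl (η-nat X (ty f))

εH-ηH-triangle : ∀ X B → ⇒H X (εH X B) ∙ ηH X (X ⇒ᶠ B) ≋ idH (X ⇒ᶠ B)
εH-ηH-triangle X B = ≋-intro refl refl (triangle₂ X B)

-- Constant formulae are even isomorphic to I, but a retraction is all that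
-- cH-RetractOfI needs.
record RetractOfI (A : Form) : Set where
  field
    section    : Hom A I
    retraction : Hom I A
    retract    : retraction ∙ section ≋ idH A
open RetractOfI

RetractOfI-[] : RetractOfI []
RetractOfI-[] = record { section = idH [] ; retraction = idH [] ; retract = identityˡ _ }

RetractOfI-++ : ∀ {A B} → RetractOfI A → RetractOfI B → RetractOfI (A ++ B)
RetractOfI-++ a b = record
  { section    = section a ⊠ section b
  ; retraction = retraction a ⊠ retraction b
  ; retract    = ⊠-inverse (retract a) (retract b)
  }

RetractOfI-⇒ : ∀ {A B} → RetractOfI A → RetractOfI B → RetractOfI (A ⇒ᶠ B)
RetractOfI-⇒ {A} {B} a b = record { section = φ ; retraction = ψ ; retract = ψ∙φ≋id }
  where
  P = A ⇒ᶠ B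
  φ : Hom P I
  φ = section b ∙ εH A B ∙ (retraction a ⊠ idH P)
  g : Hom (A ++ I) B
  g = retraction b ∙ (section a ⊠ idH I)
  ψ : Hom I P
  ψ = ⇒H A g ∙ ηH A I
  g-uncurries-φ : g ∙ (idH A ⊠ φ) ≋ εH A B
  g-uncurries-φ = begin
    (retraction b ∙ (section a ⊠ idH I)) ∙ (idH A ⊠ φ)
      ≋⟨ pullʳ (retraction b) (≋-trans (⊠-slide (section a) φ) (∙-cong (⊠-identityˡ φ) ≋-refl)) ⟩
    retraction b ∙ (φ ∙ (section a ⊠ idH P))
      ≋⟨ pullˡ (section a ⊠ idH P) (pullˡ _ (retract b)) ⟩
    (idH B ∙ εH A B ∙ (retraction a ⊠ idH P)) ∙ (section a ⊠ idH P)
      ≋⟨ ∙-cong (identityˡ _) ≋-refl ⟩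
    (εH A B ∙ (retraction a ⊠ idH P)) ∙ (section a ⊠ idH P)
      ≋⟨ pullʳ (εH A B) (⊠-inverse (retract a) (identityˡ (idH P))) ⟩
    εH A B ∙ idH (A ++ P)
      ≋⟨ identityʳ _ ⟩
    εH A B ∎
  ψ∙φ≋id : ψ ∙ φ ≋ idH P
  ψ∙φ≋id = begin
    (⇒H A g ∙ ηH A I) ∙ φ                      ≋⟨ pullʳ (⇒H A g) (ηH-natural A φ) ⟩
    ⇒H A g ∙ (⇒H A (idH A ⊠ φ) ∙ ηH A P)        ≋⟨ pullˡ (ηH A P) (≋-sym (⇒H-∙ A g (idH A ⊠ φ))) ⟩
    ⇒H A (g ∙ (idH A ⊠ φ)) ∙ ηH A P             ≋⟨ ∙-cong (⇒H-cong A g-uncurries-φ) ≋-refl ⟩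
    ⇒H A (εH A B) ∙ ηH A P                      ≋⟨ εH-ηH-triangle A B ⟩
    idH P                                       ∎

mutual
  constant-RetractOfI : ∀ {A} → Constant A → RetractOfI A
  constant-RetractOfI []       = RetractOfI-[]
  constant-RetractOfI (p ∷ ps) = RetractOfI-++ (constP-RetractOfI p) (constant-RetractOfI ps)

  constP-RetractOfI : ∀ {P} → ConstP P → RetractOfI (P ∷ [])
  constP-RetractOfI (imp a b) = RetractOfI-⇒ (constant-RetractOfI a) (constant-RetractOfI b)

cH-RetractOfI : ∀ {A} → RetractOfI A → cH A A ≋ idH (A ++ A)
cH-RetractOfI {A} a = begin
  cH A A                      ≋⟨ elimʳ (cH A A) rr∙ss≋id ⟨
  cH A A ∙ (rr ∙ ss)          ≋⟨ pullˡ ss (cH-natural r r) ⟩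
  ((r ⊠ r) ∙ cH [] []) ∙ ss   ≋⟨ ∙-cong (elimʳ (r ⊠ r) (cH-identityˡ [])) ≋-refl ⟩
  rr ∙ ss                     ≋⟨ rr∙ss≋id ⟩
  idH (A ++ A)                ∎
  where
  r = retraction a
  rr = r ⊠ r
  ss = section a ⊠ section a
  rr∙ss≋id : rr ∙ ss ≋ idH (A ++ A)
  rr∙ss≋id = ⊠-inverse (retract a) (retract a)

-- Canonical maps

-- The raw terms do not depend on the multiplicity proofs, so canonical maps
-- with the same endpoints are equal (canH-cong).
insTm : Prime → Form → Tm
insTm a [] = id [ a ]
insTm a (x ∷ C) with a ≟ₚ x
... | yes _ = id (x ∷ C)
... | no  _ = (id [ x ] ⊗ insTm a C) ∘ (c [ a ] [ x ] ⊗ id (remove a C))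

canTm : Form → Form → Tm
canTm []      C = id []
canTm (a ∷ A) C = insTm a C ∘ (id [ a ] ⊗ canTm A (remove a C))

insTm-typed : ∀ a C → a ∈ᶠ C → insTm a C ∶ a ∷ remove a C ⊢ C
insTm-typed a [] ()
insTm-typed a (x ∷ C) a∈C with a ≟ₚ x
... | yes refl = id-t (a ∷ C)
... | no  _    = ∘-t (⊗-t (c-t [ a ] [ x ]) (id-t (remove a C)))
                     (⊗-t (id-t [ x ]) (insTm-typed a C a∈C))

canTm-typed : ∀ A C → SameFactors A C → canTm A C ∶ A ⊢ C
canTm-typed [] C []∼C = subst (id [] ∶ [] ⊢_) (sym (SameFactors-[] C []∼C)) (id-t [])
canTm-typed (a ∷ A) C aA∼C =
  ∘-t (⊗-t (id-t [ a ]) (canTm-typed A (remove a C) (SameFactors-tail C aA∼C)))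
      (insTm-typed a C (∈ᶠ-head C aA∼C))

insH : ∀ a C → a ∈ᶠ C → Hom (a ∷ remove a C) C
insH a C a∈C = mk (insTm a C) (insTm-typed a C a∈C)

canH : ∀ A C → SameFactors A C → Hom A C
canH A C A∼C = mk (canTm A C) (canTm-typed A C A∼C)

insH-cong : ∀ {a C C′} a∈C a∈C′ → C ≡ C′ → insH a C a∈C ≋ insH a C′ a∈C′
insH-cong _ _ refl = ≡⇒≋ refl refl refl

canH-cong : ∀ {A C A′ C′} A∼C A′∼C′ → A ≡ A′ → C ≡ C′ → canH A C A∼C ≋ canH A′ C′ A′∼C′
canH-cong _ _ refl refl = ≡⇒≋ refl refl refl

canH-∷ : ∀ a A C aA∼C a∈C A∼C∖a →
         canH (a ∷ A) C aA∼C ≋ insH a C a∈C ∙ (idH [ a ] ⊠ canH A (remove a C) A∼C∖a)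
canH-∷ a A C _ _ _ = ≡⇒≋ refl refl refl

insH-here : ∀ a C a∈aC → insH a (a ∷ C) a∈aC ≋ idH (a ∷ C)
insH-here a C _ with a ≟ₚ a
... | yes _  = ≡⇒≋ refl refl refl
... | no a≢a = ⊥-elim (a≢a refl)

insH-there : ∀ {a x} C (a≢x : a ≢ x) a∈xC a∈C → insH a (x ∷ C) a∈xC ≋
             (idH [ x ] ⊠ insH a C a∈C) ∙ (cH [ a ] [ x ] ⊠ idH (remove a C))
insH-there {a} {x} C a≢x _ _ with a ≟ₚ x
... | yes a≡x = ⊥-elim (a≢x a≡x)
... | no  _   = ≡⇒≋ refl refl refl

canH-identity : ∀ B B∼B → canH B B B∼B ≋ idH B
canH-identity []      _    = ≋-refl
canH-identity (b ∷ B) bB∼bB = begin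
  canH (b ∷ B) (b ∷ B) bB∼bB
    ≋⟨ canH-∷ b B (b ∷ B) bB∼bB (∈ᶠ-here b B) (SameFactors-tail (b ∷ B) bB∼bB) ⟩
  insH b (b ∷ B) _ ∙ (idH [ b ] ⊠ canH B (remove b (b ∷ B)) _)
    ≋⟨ ∙-cong (insH-here b B _) (⊠-cong ≋-refl (≋-trans (canH-cong _ B∼B refl (remove-here b B))
                                                          (canH-identity B B∼B))) ⟩
  idH (b ∷ B) ∙ (idH [ b ] ⊠ idH B)
    ≋⟨ elimˡ _ ≋-refl ⟩
  idH [ b ] ⊠ idH B
    ≋⟨ idH-⊠ [ b ] B ⟩
  idH (b ∷ B) ∎
  where
  B∼B : SameFactors B B
  B∼B _ = refl

cH-yang-baxter : ∀ p q x →
  (cH [ q ] [ x ] ⊠ idH [ p ]) ∙ (idH [ q ] ⊠ cH [ p ] [ x ]) ∙ (cH [ p ] [ q ] ⊠ idH [ x ]) ≋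
  (idH [ x ] ⊠ cH [ p ] [ q ]) ∙ (cH [ p ] [ x ] ⊠ idH [ q ]) ∙ (idH [ p ] ⊠ cH [ q ] [ x ])
cH-yang-baxter p q x = begin
  (cH [ q ] [ x ] ⊠ idH [ p ]) ∙ (idH [ q ] ⊠ cH [ p ] [ x ]) ∙ (cH [ p ] [ q ] ⊠ idH [ x ])
    ≋⟨ pullˡ _ (≋-sym (cH-hexagon [ q ] [ p ] [ x ])) ⟩
  cH (q ∷ p ∷ []) [ x ] ∙ (cH [ p ] [ q ] ⊠ idH [ x ])
    ≋⟨ cH-natural (cH [ p ] [ q ]) (idH [ x ]) ⟩
  (idH [ x ] ⊠ cH [ p ] [ q ]) ∙ cH (p ∷ q ∷ []) [ x ]
    ≋⟨ ∙-cong ≋-refl (cH-hexagon [ p ] [ q ] [ x ]) ⟩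
  (idH [ x ] ⊠ cH [ p ] [ q ]) ∙ (cH [ p ] [ x ] ⊠ idH [ q ]) ∙ (idH [ p ] ⊠ cH [ q ] [ x ]) ∎

cH-yang-baxter-⊠ : ∀ p q x D →
  (cH [ q ] [ x ] ⊠ idH (p ∷ D)) ∙ (idH [ q ] ⊠ cH [ p ] [ x ] ⊠ idH D) ∙ (cH [ p ] [ q ] ⊠ idH (x ∷ D)) ≋
  (idH [ x ] ⊠ cH [ p ] [ q ] ⊠ idH D) ∙ (cH [ p ] [ x ] ⊠ idH (q ∷ D)) ∙ (idH [ p ] ⊠ cH [ q ] [ x ] ⊠ idH D)
cH-yang-baxter-⊠ p q x D = begin
  (cH [ q ] [ x ] ⊠ idH (p ∷ D)) ∙ (idH [ q ] ⊠ cH [ p ] [ x ] ⊠ idH D) ∙ (cH [ p ] [ q ] ⊠ idH (x ∷ D))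
    ≋⟨ ∙-cong (⊠id-∷ p _) (∙-cong (≋-sym (⊠-assoc _ _ _)) (⊠id-∷ x _)) ⟨
  ((cH [ q ] [ x ] ⊠ idH [ p ]) ⊠ idH D) ∙ ((idH [ q ] ⊠ cH [ p ] [ x ]) ⊠ idH D) ∙ ((cH [ p ] [ q ] ⊠ idH [ x ]) ⊠ idH D)
    ≋⟨ ∙-⊠id³ _ _ _ ⟨
  ((cH [ q ] [ x ] ⊠ idH [ p ]) ∙ (idH [ q ] ⊠ cH [ p ] [ x ]) ∙ (cH [ p ] [ q ] ⊠ idH [ x ])) ⊠ idH D
    ≋⟨ ⊠-cong (cH-yang-baxter p q x) ≋-refl ⟩
  ((idH [ x ] ⊠ cH [ p ] [ q ]) ∙ (cH [ p ] [ x ] ⊠ idH [ q ]) ∙ (idH [ p ] ⊠ cH [ q ] [ x ])) ⊠ idH D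
    ≋⟨ ∙-⊠id³ _ _ _ ⟩
  ((idH [ x ] ⊠ cH [ p ] [ q ]) ⊠ idH D) ∙ ((cH [ p ] [ x ] ⊠ idH [ q ]) ⊠ idH D) ∙ ((idH [ p ] ⊠ cH [ q ] [ x ]) ⊠ idH D)
    ≋⟨ ∙-cong (≋-sym (⊠-assoc _ _ _)) (∙-cong (⊠id-∷ q _) (≋-sym (⊠-assoc _ _ _))) ⟩
  (idH [ x ] ⊠ cH [ p ] [ q ] ⊠ idH D) ∙ (cH [ p ] [ x ] ⊠ idH (q ∷ D)) ∙ (idH [ p ] ⊠ cH [ q ] [ x ] ⊠ idH D) ∎
  where
  ⊠id-∷ : ∀ {A B} a (f : Hom A B) → (f ⊠ idH [ a ]) ⊠ idH D ≋ f ⊠ idH (a ∷ D)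
  ⊠id-∷ a f = ≋-trans (≋-sym (⊠-assoc _ _ _)) (⊠-cong ≋-refl (idH-⊠ [ a ] D))
  ∙-⊠id³ : ∀ {A B C E} (h : Hom C E) (g : Hom B C) (f : Hom A B) →
           (h ∙ g ∙ f) ⊠ idH D ≋ (h ⊠ idH D) ∙ (g ⊠ idH D) ∙ (f ⊠ idH D)
  ∙-⊠id³ h g f = ≋-trans (∙-⊠id h (g ∙ f)) (∙-cong ≋-refl (∙-⊠id g f))

cH⊠id-slide : ∀ {A B} a b (f : Hom A B) →
  (cH [ a ] [ b ] ⊠ idH B) ∙ (idH [ a ] ⊠ idH [ b ] ⊠ f) ≋ (idH [ b ] ⊠ idH [ a ] ⊠ f) ∙ (cH [ a ] [ b ] ⊠ idH A)
cH⊠id-slide a b f = begin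
  (cH [ a ] [ b ] ⊠ idH _) ∙ (idH [ a ] ⊠ idH [ b ] ⊠ f)   ≋⟨ ∙-cong ≋-refl (idH-⊠-assoc [ a ] [ b ] f) ⟩
  (cH [ a ] [ b ] ⊠ idH _) ∙ (idH (a ∷ b ∷ []) ⊠ f)       ≋⟨ ⊠-slide (cH [ a ] [ b ]) f ⟩
  (idH (b ∷ a ∷ []) ⊠ f) ∙ (cH [ a ] [ b ] ⊠ idH _)       ≋⟨ ∙-cong (idH-⊠-assoc [ b ] [ a ] f) ≋-refl ⟨
  (idH [ b ] ⊠ idH [ a ] ⊠ f) ∙ (cH [ a ] [ b ] ⊠ idH _)   ∎

-- Inserting a and then b into x ∷ C when neither is x: both factors can be
-- moved past x after, rather than between, the insertions into C.
insH-past : ∀ x {a b R D C′} (I : Hom (a ∷ R) C′) (J : Hom (b ∷ D) R) →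
  ((idH [ x ] ⊠ I) ∙ (cH [ a ] [ x ] ⊠ idH R)) ∙ (idH [ a ] ⊠ ((idH [ x ] ⊠ J) ∙ (cH [ b ] [ x ] ⊠ idH D))) ≋
  (idH [ x ] ⊠ (I ∙ (idH [ a ] ⊠ J))) ∙ (cH [ a ] [ x ] ⊠ idH (b ∷ D)) ∙ (idH [ a ] ⊠ cH [ b ] [ x ] ⊠ idH D)
insH-past x {a} {b} {R} {D} I J = begin
  ((idH [ x ] ⊠ I) ∙ (cH [ a ] [ x ] ⊠ idH R)) ∙ (idH [ a ] ⊠ ((idH [ x ] ⊠ J) ∙ cbx))
    ≋⟨ pullʳ (idH [ x ] ⊠ I) (∙-cong ≋-refl (id⊠-∙ _ _)) ⟩
  (idH [ x ] ⊠ I) ∙ (cH [ a ] [ x ] ⊠ idH R) ∙ (idH [ a ] ⊠ idH [ x ] ⊠ J) ∙ (idH [ a ] ⊠ cbx)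
    ≋⟨ ∙-cong ≋-refl (pullˡ _ (cH⊠id-slide a x J)) ⟩
  (idH [ x ] ⊠ I) ∙ ((idH [ x ] ⊠ idH [ a ] ⊠ J) ∙ (cH [ a ] [ x ] ⊠ idH (b ∷ D))) ∙ (idH [ a ] ⊠ cbx)
    ≋⟨ ∙-cong ≋-refl (assoc _ _ _) ⟩
  (idH [ x ] ⊠ I) ∙ (idH [ x ] ⊠ idH [ a ] ⊠ J) ∙ (cH [ a ] [ x ] ⊠ idH (b ∷ D)) ∙ (idH [ a ] ⊠ cbx)
    ≋⟨ pullˡ _ (≋-sym (id⊠-∙ I (idH [ a ] ⊠ J))) ⟩
  (idH [ x ] ⊠ (I ∙ (idH [ a ] ⊠ J))) ∙ (cH [ a ] [ x ] ⊠ idH (b ∷ D)) ∙ (idH [ a ] ⊠ cbx) ∎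
  where
  cbx = cH [ b ] [ x ] ⊠ idH D

insH₂ : ∀ a b C → a ∈ᶠ C → b ∈ᶠ remove a C → Hom (a ∷ b ∷ remove b (remove a C)) C
insH₂ a b C a∈C b∈C∖a = insH a C a∈C ∙ (idH [ a ] ⊠ insH b (remove a C) b∈C∖a)

∈ᶠ-remove-there : ∀ {a b x} C → a ≢ x → b ≢ x → b ∈ᶠ remove a (x ∷ C) → b ∈ᶠ remove a C
∈ᶠ-remove-there C a≢x b≢x b∈ = ∈ᶠ-there _ b≢x (subst (_ ∈ᶠ_) (remove-there C a≢x) b∈)

insH₂-there : ∀ {a b x} C (a≢x : a ≢ x) (b≢x : b ≢ x) a∈xC b∈xC∖a →
  insH₂ a b (x ∷ C) a∈xC b∈xC∖a ≋
  ((idH [ x ] ⊠ insH a C (∈ᶠ-there C a≢x a∈xC)) ∙ (cH [ a ] [ x ] ⊠ idH (remove a C))) ∙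
  (idH [ a ] ⊠ ((idH [ x ] ⊠ insH b (remove a C) (∈ᶠ-remove-there C a≢x b≢x b∈xC∖a)) ∙
                (cH [ b ] [ x ] ⊠ idH (remove b (remove a C)))))
insH₂-there {a} {b} {x} C a≢x b≢x a∈xC b∈xC∖a =
  ∙-cong (insH-there C a≢x a∈xC _)
         (⊠-cong ≋-refl (≋-trans (insH-cong b∈xC∖a b∈x∷C∖a (remove-there C a≢x))
                                 (insH-there (remove a C) b≢x b∈x∷C∖a _)))
  where
  b∈x∷C∖a : b ∈ᶠ x ∷ remove a C
  b∈x∷C∖a = subst (b ∈ᶠ_) (remove-there C a≢x) b∈xC∖a

insH-swap-at-first : ∀ {p q} C → q ≢ p → ∀ p∈pC q∈pC p∈pC∖q q∈pC∖p →
  insH₂ q p (p ∷ C) q∈pC p∈pC∖q ∙ (cH [ p ] [ q ] ⊠ idH (remove p (remove q (p ∷ C)))) ≋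
  insH₂ p q (p ∷ C) p∈pC q∈pC∖p
insH-swap-at-first {p} {q} C q≢p p∈pC q∈pC p∈pC∖q q∈pC∖p = begin
  insH₂ q p (p ∷ C) q∈pC p∈pC∖q ∙ (cH [ p ] [ q ] ⊠ idH (remove p (remove q (p ∷ C))))
    ≋⟨ ∙-cong (∙-cong (insH-there C q≢p q∈pC q∈C)
                      (⊠-cong ≋-refl (≋-trans (insH-cong p∈pC∖q (∈ᶠ-here p R) (remove-there C q≢p))
                                              (insH-here p R _))))
              (⊠-cong ≋-refl (idH-cong (trans (cong (remove p) (remove-there C q≢p)) (remove-here p R)))) ⟩
  (((idH [ p ] ⊠ Iq) ∙ (cH [ q ] [ p ] ⊠ idH R)) ∙ (idH [ q ] ⊠ idH (p ∷ R))) ∙ (cH [ p ] [ q ] ⊠ idH R)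
    ≋⟨ ∙-cong (elimʳ _ (idH-⊠ [ q ] (p ∷ R))) ≋-refl ⟩
  ((idH [ p ] ⊠ Iq) ∙ (cH [ q ] [ p ] ⊠ idH R)) ∙ (cH [ p ] [ q ] ⊠ idH R)
    ≋⟨ ≋-trans (assoc _ _ _) (elimʳ _ (⊠-inverse (cH-inverse [ p ] [ q ]) (identityˡ (idH R)))) ⟩
  idH [ p ] ⊠ Iq
    ≋⟨ ≋-trans (∙-cong (insH-here p C p∈pC) (⊠-cong ≋-refl (insH-cong q∈pC∖p q∈C (remove-here p C))))
               (identityˡ _) ⟨
  insH₂ p q (p ∷ C) p∈pC q∈pC∖p ∎
  where
  q∈C = ∈ᶠ-there C q≢p q∈pC
  Iq = insH q C q∈C
  R = remove q C

insH-swap-at-second : ∀ {p q} C → p ≢ q → ∀ p∈qC q∈qC p∈qC∖q q∈qC∖p →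
  insH₂ q p (q ∷ C) q∈qC p∈qC∖q ∙ (cH [ p ] [ q ] ⊠ idH (remove p (remove q (q ∷ C)))) ≋
  insH₂ p q (q ∷ C) p∈qC q∈qC∖p
insH-swap-at-second {p} {q} C p≢q p∈qC q∈qC p∈qC∖q q∈qC∖p = begin
  insH₂ q p (q ∷ C) q∈qC p∈qC∖q ∙ (cH [ p ] [ q ] ⊠ idH (remove p (remove q (q ∷ C))))
    ≋⟨ ∙-cong (∙-cong (insH-here q C q∈qC) (⊠-cong ≋-refl (insH-cong p∈qC∖q p∈C (remove-here q C))))
              (⊠-cong ≋-refl (idH-cong (cong (remove p) (remove-here q C)))) ⟩
  (idH (q ∷ C) ∙ (idH [ q ] ⊠ Ip)) ∙ (cH [ p ] [ q ] ⊠ idH R)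
    ≋⟨ ∙-cong (identityˡ _) ≋-refl ⟩
  (idH [ q ] ⊠ Ip) ∙ (cH [ p ] [ q ] ⊠ idH R)
    ≋⟨ elimʳ _ (idH-⊠ [ p ] (q ∷ R)) ⟨
  ((idH [ q ] ⊠ Ip) ∙ (cH [ p ] [ q ] ⊠ idH R)) ∙ (idH [ p ] ⊠ idH (q ∷ R))
    ≋⟨ ∙-cong (insH-there C p≢q p∈qC p∈C)
              (⊠-cong ≋-refl (≋-trans (insH-cong q∈qC∖p (∈ᶠ-here q R) (remove-there C p≢q))
                                      (insH-here q R _))) ⟨
  insH₂ p q (q ∷ C) p∈qC q∈qC∖p ∎
  where
  p∈C = ∈ᶠ-there C p≢q p∈qC
  Ip = insH p C p∈C
  R = remove p C

insH-swap-past : ∀ {p q x} C (p≢x : p ≢ x) (q≢x : q ≢ x) (p≢q : p ≢ q) p∈xC q∈xC p∈xC∖q q∈xC∖p →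
  insH₂ q p C (∈ᶠ-there C q≢x q∈xC) (∈ᶠ-remove-there C q≢x p≢x p∈xC∖q) ∙
    (cH [ p ] [ q ] ⊠ idH (remove p (remove q C))) ≋
  insH₂ p q C (∈ᶠ-there C p≢x p∈xC) (∈ᶠ-remove-there C p≢x q≢x q∈xC∖p) →
  insH₂ q p (x ∷ C) q∈xC p∈xC∖q ∙ (cH [ p ] [ q ] ⊠ idH (remove p (remove q (x ∷ C)))) ≋
  insH₂ p q (x ∷ C) p∈xC q∈xC∖p
insH-swap-past {p} {q} {x} C p≢x q≢x p≢q p∈xC q∈xC p∈xC∖q q∈xC∖p swap-in-C = begin
  insH₂ q p (x ∷ C) q∈xC p∈xC∖q ∙ (cH [ p ] [ q ] ⊠ idH (remove p (remove q (x ∷ C))))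
    ≋⟨ ∙-cong (insH₂-there C q≢x p≢x q∈xC p∈xC∖q) (⊠-cong ≋-refl (idH-cong D-there)) ⟩
  (((idH [ x ] ⊠ Iq) ∙ (cH [ q ] [ x ] ⊠ idH (remove q C))) ∙
    (idH [ q ] ⊠ ((idH [ x ] ⊠ Ip) ∙ (cH [ p ] [ x ] ⊠ idH D)))) ∙ (cH [ p ] [ q ] ⊠ idH (x ∷ D))
    ≋⟨ ∙-cong (insH-past x Iq Ip) ≋-refl ⟩
  ((idH [ x ] ⊠ (Iq ∙ (idH [ q ] ⊠ Ip))) ∙ (cH [ q ] [ x ] ⊠ idH (p ∷ D)) ∙
    (idH [ q ] ⊠ cH [ p ] [ x ] ⊠ idH D)) ∙ (cH [ p ] [ q ] ⊠ idH (x ∷ D))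
    ≋⟨ ≋-trans (assoc _ _ _) (∙-cong ≋-refl (≋-trans (assoc _ _ _) (cH-yang-baxter-⊠ p q x D))) ⟩
  (idH [ x ] ⊠ (Iq ∙ (idH [ q ] ⊠ Ip))) ∙ (idH [ x ] ⊠ cH [ p ] [ q ] ⊠ idH D) ∙
    (cH [ p ] [ x ] ⊠ idH (q ∷ D)) ∙ (idH [ p ] ⊠ cH [ q ] [ x ] ⊠ idH D)
    ≋⟨ pullˡ _ (≋-sym (id⊠-∙ _ _)) ⟩
  (idH [ x ] ⊠ ((Iq ∙ (idH [ q ] ⊠ Ip)) ∙ (cH [ p ] [ q ] ⊠ idH D))) ∙
    (cH [ p ] [ x ] ⊠ idH (q ∷ D)) ∙ (idH [ p ] ⊠ cH [ q ] [ x ] ⊠ idH D)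
    ≋⟨ ∙-cong (⊠-cong ≋-refl swap-in-C)
              (∙-cong (⊠-cong ≋-refl (idH-cong (cong (q ∷_) D≡D′)))
                      (⊠-cong ≋-refl (⊠-cong ≋-refl (idH-cong D≡D′)))) ⟩
  (idH [ x ] ⊠ (Ip′ ∙ (idH [ p ] ⊠ Iq′))) ∙
    (cH [ p ] [ x ] ⊠ idH (q ∷ D′)) ∙ (idH [ p ] ⊠ cH [ q ] [ x ] ⊠ idH D′)
    ≋⟨ insH-past x Ip′ Iq′ ⟨
  ((idH [ x ] ⊠ Ip′) ∙ (cH [ p ] [ x ] ⊠ idH (remove p C))) ∙
    (idH [ p ] ⊠ ((idH [ x ] ⊠ Iq′) ∙ (cH [ q ] [ x ] ⊠ idH D′)))
    ≋⟨ insH₂-there C p≢x q≢x p∈xC q∈xC∖p ⟨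
  insH₂ p q (x ∷ C) p∈xC q∈xC∖p ∎
  where
  D = remove p (remove q C)
  D′ = remove q (remove p C)
  D≡D′ = remove-comm C p≢q
  D-there : remove p (remove q (x ∷ C)) ≡ x ∷ D
  D-there = trans (cong (remove p) (remove-there C q≢x)) (remove-there (remove q C) p≢x)
  Iq = insH q C (∈ᶠ-there C q≢x q∈xC)
  Ip = insH p (remove q C) (∈ᶠ-remove-there C q≢x p≢x p∈xC∖q)
  Ip′ = insH p C (∈ᶠ-there C p≢x p∈xC)
  Iq′ = insH q (remove p C) (∈ᶠ-remove-there C p≢x q≢x q∈xC∖p)

insH-swap : ∀ {p q} C → p ≢ q → ∀ p∈C q∈C p∈C∖q q∈C∖p →
  insH₂ q p C q∈C p∈C∖q ∙ (cH [ p ] [ q ] ⊠ idH (remove p (remove q C))) ≋ insH₂ p q C p∈C q∈C∖p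
insH-swap [] _ () _ _ _
insH-swap {p} {q} (x ∷ C) p≢q = by-cases (p ≟ₚ x) (q ≟ₚ x)
  where
  by-cases : Dec (p ≡ x) → Dec (q ≡ x) → ∀ p∈xC q∈xC p∈xC∖q q∈xC∖p →
    insH₂ q p (x ∷ C) q∈xC p∈xC∖q ∙ (cH [ p ] [ q ] ⊠ idH (remove p (remove q (x ∷ C)))) ≋
    insH₂ p q (x ∷ C) p∈xC q∈xC∖p
  by-cases (yes refl) (yes refl) = ⊥-elim (p≢q refl)
  by-cases (yes refl) (no q≢p)   = insH-swap-at-first C q≢p
  by-cases (no _)     (yes refl) = insH-swap-at-second C p≢q
  by-cases (no p≢x)   (no q≢x) p∈xC q∈xC p∈xC∖q q∈xC∖p =
    insH-swap-past C p≢x q≢x p≢q p∈xC q∈xC p∈xC∖q q∈xC∖p (insH-swap C p≢q _ _ _ _)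

canH-∷∷ : ∀ a b Z C abZ∼C a∈C b∈C∖a Z∼C∖a∖b →
  canH (a ∷ b ∷ Z) C abZ∼C ≋
  insH₂ a b C a∈C b∈C∖a ∙ (idH [ a ] ⊠ idH [ b ] ⊠ canH Z (remove b (remove a C)) Z∼C∖a∖b)
canH-∷∷ a b Z C abZ∼C a∈C b∈C∖a Z∼C∖a∖b = begin
  canH (a ∷ b ∷ Z) C abZ∼C
    ≋⟨ ≡⇒≋ refl refl refl ⟩
  insH a C a∈C ∙ (idH [ a ] ⊠ (insH b (remove a C) b∈C∖a ∙ (idH [ b ] ⊠ K)))
    ≋⟨ ∙-cong ≋-refl (id⊠-∙ _ _) ⟩
  insH a C a∈C ∙ (idH [ a ] ⊠ insH b (remove a C) b∈C∖a) ∙ (idH [ a ] ⊠ idH [ b ] ⊠ K)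
    ≋⟨ assoc _ _ _ ⟨
  insH₂ a b C a∈C b∈C∖a ∙ (idH [ a ] ⊠ idH [ b ] ⊠ K) ∎
  where
  K = canH Z (remove b (remove a C)) Z∼C∖a∖b

canH-swap-head : ∀ {p q} Z C → p ≢ q → ∀ pqZ∼C qpZ∼C →
  canH (q ∷ p ∷ Z) C qpZ∼C ∙ (cH [ p ] [ q ] ⊠ idH Z) ≋ canH (p ∷ q ∷ Z) C pqZ∼C
canH-swap-head {p} {q} Z C p≢q pqZ∼C qpZ∼C = begin
  canH (q ∷ p ∷ Z) C qpZ∼C ∙ (cH [ p ] [ q ] ⊠ idH Z)
    ≋⟨ ∙-cong (canH-∷∷ q p Z C qpZ∼C q∈C p∈C∖q Z∼D) ≋-refl ⟩
  (insH₂ q p C q∈C p∈C∖q ∙ (idH [ q ] ⊠ idH [ p ] ⊠ K)) ∙ (cH [ p ] [ q ] ⊠ idH Z)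
    ≋⟨ pullʳ _ (≋-sym (cH⊠id-slide p q K)) ⟩
  insH₂ q p C q∈C p∈C∖q ∙ (cH [ p ] [ q ] ⊠ idH D) ∙ (idH [ p ] ⊠ idH [ q ] ⊠ K)
    ≋⟨ assoc _ _ _ ⟨
  (insH₂ q p C q∈C p∈C∖q ∙ (cH [ p ] [ q ] ⊠ idH D)) ∙ (idH [ p ] ⊠ idH [ q ] ⊠ K)
    ≋⟨ ∙-cong (insH-swap C p≢q p∈C q∈C p∈C∖q q∈C∖p)
              (⊠-cong ≋-refl (⊠-cong ≋-refl (canH-cong Z∼D Z∼D′ refl (remove-comm C p≢q)))) ⟩
  insH₂ p q C p∈C q∈C∖p ∙ (idH [ p ] ⊠ idH [ q ] ⊠ canH Z D′ Z∼D′)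
    ≋⟨ canH-∷∷ p q Z C pqZ∼C p∈C q∈C∖p Z∼D′ ⟨
  canH (p ∷ q ∷ Z) C pqZ∼C ∎
  where
  D = remove p (remove q C)
  D′ = remove q (remove p C)
  q∈C = ∈ᶠ-head C qpZ∼C
  p∈C∖q = ∈ᶠ-head (remove q C) (SameFactors-tail C qpZ∼C)
  Z∼D = SameFactors-tail (remove q C) (SameFactors-tail C qpZ∼C)
  p∈C = ∈ᶠ-head C pqZ∼C
  q∈C∖p = ∈ᶠ-head (remove p C) (SameFactors-tail C pqZ∼C)
  Z∼D′ = SameFactors-tail (remove p C) (SameFactors-tail C pqZ∼C)
  K = canH Z D Z∼D

canH-swap : ∀ {p q} X Z C → p ≢ q → ∀ pq∼C qp∼C →
  canH (X ++ q ∷ p ∷ Z) C qp∼C ∙ (idH X ⊠ cH [ p ] [ q ] ⊠ idH Z) ≋ canH (X ++ p ∷ q ∷ Z) C pq∼C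
canH-swap [] Z C p≢q pq∼C qp∼C =
  ≋-trans (∙-cong ≋-refl (⊠-identityˡ _)) (canH-swap-head Z C p≢q pq∼C qp∼C)
canH-swap {p} {q} (x ∷ X) Z C p≢q pq∼C qp∼C = begin
  canH (x ∷ X ++ q ∷ p ∷ Z) C qp∼C ∙ (idH (x ∷ X) ⊠ s)
    ≋⟨ ∙-cong (canH-∷ x _ C qp∼C x∈C qp∼C∖x) (≋-sym (idH-⊠-assoc [ x ] X s)) ⟩
  (insH x C x∈C ∙ (idH [ x ] ⊠ canH (X ++ q ∷ p ∷ Z) (remove x C) qp∼C∖x)) ∙ (idH [ x ] ⊠ idH X ⊠ s)
    ≋⟨ pullʳ _ (≋-sym (id⊠-∙ _ _)) ⟩
  insH x C x∈C ∙ (idH [ x ] ⊠ (canH (X ++ q ∷ p ∷ Z) (remove x C) qp∼C∖x ∙ (idH X ⊠ s)))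
    ≋⟨ ∙-cong ≋-refl (⊠-cong ≋-refl (canH-swap X Z (remove x C) p≢q pq∼C∖x qp∼C∖x)) ⟩
  insH x C x∈C ∙ (idH [ x ] ⊠ canH (X ++ p ∷ q ∷ Z) (remove x C) pq∼C∖x)
    ≋⟨ canH-∷ x _ C pq∼C x∈C pq∼C∖x ⟨
  canH (x ∷ X ++ p ∷ q ∷ Z) C pq∼C ∎
  where
  s = cH [ p ] [ q ] ⊠ idH Z
  x∈C = ∈ᶠ-head C pq∼C
  pq∼C∖x = SameFactors-tail C pq∼C
  qp∼C∖x = SameFactors-tail C qp∼C

-- Coherence of central maps

record Coherent {A B} (s : Hom A B) : Set where
  field
    preserves : SameFactors A B
    absorbed  : CountAssorted A → ∀ C A∼C B∼C → canH B C B∼C ∙ s ≋ canH A C A∼C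
open Coherent

Coherent-resp-≋ : ∀ {A B A′ B′} {s : Hom A B} {s′ : Hom A′ B′} → s ≋ s′ → Coherent s′ → Coherent s
Coherent-resp-≋ s≋s′@(≋-intro refl refl _) coh = record
  { preserves = preserves coh
  ; absorbed  = λ assorted C A∼C B∼C → ≋-trans (∙-cong ≋-refl s≋s′) (absorbed coh assorted C A∼C B∼C)
  }

Coherent-id : ∀ A → Coherent (idH A)
Coherent-id A = record
  { preserves = λ _ → refl
  ; absorbed  = λ _ C A∼C A∼C′ → ≋-trans (identityʳ _) (canH-cong A∼C′ A∼C refl refl)
  }

Coherent-∙ : ∀ {A B C} {s : Hom A B} {t : Hom B C} → Coherent s → Coherent t → Coherent (t ∙ s)
Coherent-∙ {A} {B} {s = s} {t} coh-s coh-t = record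
  { preserves = λ p → trans (preserves coh-s p) (preserves coh-t p)
  ; absorbed  = λ assorted D A∼D C∼D →
      let B∼D = λ p → trans (sym (preserves coh-s p)) (A∼D p) in
      ≋-trans (≋-sym (assoc _ t s))
        (≋-trans (∙-cong (absorbed coh-t (CountAssorted-resp {A} {B} (preserves coh-s) assorted) D B∼D C∼D) ≋-refl)
                 (absorbed coh-s assorted D A∼D B∼D))
  }

Coherent-inverse : ∀ {A B} {s : Hom A B} (t : Hom B A) → s ∙ t ≋ idH B → Coherent s → Coherent t
Coherent-inverse {A} {B} {s = s} t s∙t≋id coh = record
  { preserves = λ p → sym (preserves coh p)
  ; absorbed  = λ assorted C B∼C A∼C →
      ≋-trans (∙-cong (≋-sym (absorbed coh (CountAssorted-resp {B} {A} (λ p → sym (preserves coh p)) assorted)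
                                         C A∼C B∼C)) ≋-refl)
              (≋-trans (assoc _ s t) (elimʳ _ s∙t≋id))
  }

StablyCoherent : ∀ {A B} → Hom A B → Set
StablyCoherent s = ∀ X Z → Coherent (idH X ⊠ s ⊠ idH Z)

StablyCoherent-resp-≋ : ∀ {A B A′ B′} {s : Hom A B} {s′ : Hom A′ B′} →
                        s ≋ s′ → StablyCoherent s′ → StablyCoherent s
StablyCoherent-resp-≋ s≋s′ coh X Z = Coherent-resp-≋ (⊠-cong ≋-refl (⊠-cong s≋s′ ≋-refl)) (coh X Z)

StablyCoherent-id : ∀ A → StablyCoherent (idH A)
StablyCoherent-id A X Z =
  Coherent-resp-≋ (≋-trans (⊠-cong ≋-refl (idH-⊠ A Z)) (idH-⊠ X (A ++ Z))) (Coherent-id _)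

StablyCoherent-∙ : ∀ {A B C} {s : Hom A B} {t : Hom B C} →
                   StablyCoherent s → StablyCoherent t → StablyCoherent (t ∙ s)
StablyCoherent-∙ {s = s} {t} coh-s coh-t X Z =
  Coherent-resp-≋ (≋-trans (⊠-cong ≋-refl (∙-⊠id t s)) (id⊠-∙ _ _)) (Coherent-∙ (coh-s X Z) (coh-t X Z))

StablyCoherent-inverse : ∀ {A B} {s : Hom A B} (t : Hom B A) →
                         s ∙ t ≋ idH B → StablyCoherent s → StablyCoherent t
StablyCoherent-inverse {B = B} {s} t s∙t≋id coh X Z = Coherent-inverse _ whiskered-inverse (coh X Z)
  where
  whiskered-inverse : (idH X ⊠ s ⊠ idH Z) ∙ (idH X ⊠ t ⊠ idH Z) ≋ idH (X ++ B ++ Z)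
  whiskered-inverse = ⊠-inverse (identityˡ (idH X)) (⊠-inverse s∙t≋id (identityˡ (idH Z)))

StablyCoherent-⊠ : ∀ {A₁ B₁ A₂ B₂} {s : Hom A₁ B₁} {t : Hom A₂ B₂} →
                   StablyCoherent s → StablyCoherent t → StablyCoherent (s ⊠ t)
StablyCoherent-⊠ {A₁} {B₁} {A₂} {B₂} {s} {t} coh-s coh-t X Z =
  Coherent-resp-≋ one-after-other
    (Coherent-∙ (Coherent-resp-≋ (cast-≋ _ _ _) (coh-t (X ++ A₁) Z)) (coh-s X (B₂ ++ Z)))
  where
  one-after-other : idH X ⊠ (s ⊠ t) ⊠ idH Z ≋
    (idH X ⊠ s ⊠ idH (B₂ ++ Z)) ∙
    cast (++-assoc X A₁ (A₂ ++ Z)) (++-assoc X A₁ (B₂ ++ Z)) (idH (X ++ A₁) ⊠ t ⊠ idH Z)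
  one-after-other = begin
    idH X ⊠ (s ⊠ t) ⊠ idH Z
      ≋⟨ ⊠-cong ≋-refl (⊠-assoc s t (idH Z)) ⟨
    idH X ⊠ s ⊠ t ⊠ idH Z
      ≋⟨ ⊠-cong ≋-refl (⊠-factorˡ s (t ⊠ idH Z)) ⟩
    idH X ⊠ ((s ⊠ idH (B₂ ++ Z)) ∙ (idH A₁ ⊠ t ⊠ idH Z))
      ≋⟨ id⊠-∙ _ _ ⟩
    (idH X ⊠ s ⊠ idH (B₂ ++ Z)) ∙ (idH X ⊠ idH A₁ ⊠ t ⊠ idH Z)
      ≋⟨ ∙-cong ≋-refl (≋-trans (idH-⊠-assoc X A₁ _) (≋-sym (cast-≋ _ _ _))) ⟩
    (idH X ⊠ s ⊠ idH (B₂ ++ Z)) ∙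
    cast (++-assoc X A₁ (A₂ ++ Z)) (++-assoc X A₁ (B₂ ++ Z)) (idH (X ++ A₁) ⊠ t ⊠ idH Z) ∎

StablyCoherent-cH-primes : ∀ p q → StablyCoherent (cH [ p ] [ q ])
StablyCoherent-cH-primes p q X Z = record
  { preserves = SameFactors-whisker X Z (SameFactors-swap [ p ] [ q ])
  ; absorbed  = absorbed-swap (p ≟ₚ q)
  }
  where
  absorbed-swap : Dec (p ≡ q) → CountAssorted (X ++ p ∷ q ∷ Z) → ∀ C A∼C B∼C →
    canH (X ++ q ∷ p ∷ Z) C B∼C ∙ (idH X ⊠ cH [ p ] [ q ] ⊠ idH Z) ≋ canH (X ++ p ∷ q ∷ Z) C A∼C
  absorbed-swap (no p≢q)  _        C A∼C B∼C = canH-swap X Z C p≢q A∼C B∼C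
  absorbed-swap (yes refl) assorted C A∼C B∼C =
    ≋-trans (elimʳ _ swap≋id) (canH-cong B∼C A∼C refl refl)
    where
    swap≋id : idH X ⊠ cH [ p ] [ p ] ⊠ idH Z ≋ idH (X ++ p ∷ p ∷ Z)
    swap≋id = ≋-trans (⊠-cong ≋-refl (≋-trans (⊠-cong pp≋id ≋-refl) (idH-⊠ _ Z))) (idH-⊠ X _)
      where
      pp≋id = cH-RetractOfI (constP-RetractOfI (CountAssorted-repeated X Z assorted))

StablyCoherent-cH-prime-left : ∀ Y a → StablyCoherent (cH Y [ a ])
StablyCoherent-cH-prime-left []      a =
  StablyCoherent-resp-≋ (cH-identityˡ [ a ]) (StablyCoherent-id [ a ])
StablyCoherent-cH-prime-left (y ∷ Y) a =
  StablyCoherent-resp-≋ (cH-hexagon [ y ] Y [ a ])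
    (StablyCoherent-∙ (StablyCoherent-⊠ (StablyCoherent-id [ y ]) (StablyCoherent-cH-prime-left Y a))
                      (StablyCoherent-⊠ (StablyCoherent-cH-primes y a) (StablyCoherent-id Y)))

StablyCoherent-cH : ∀ Y₁ Y₂ → StablyCoherent (cH Y₁ Y₂)
StablyCoherent-cH []       Y₂ = StablyCoherent-resp-≋ (cH-identityˡ Y₂) (StablyCoherent-id Y₂)
StablyCoherent-cH (a ∷ Y₁) Y₂ =
  StablyCoherent-resp-≋ (cH-hexagon [ a ] Y₁ Y₂)
    (StablyCoherent-∙ (StablyCoherent-⊠ (StablyCoherent-id [ a ]) (StablyCoherent-cH Y₁ Y₂))
                      (StablyCoherent-resp-≋ (cast-≋ _ _ _)
                        (StablyCoherent-⊠ cH-a-Y₂ (StablyCoherent-id Y₁))))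
  where
  cH-a-Y₂ : StablyCoherent (cH [ a ] Y₂)
  cH-a-Y₂ = StablyCoherent-inverse (cH [ a ] Y₂) (cH-inverse [ a ] Y₂)
              (StablyCoherent-cH-prime-left Y₂ a)

central-StablyCoherent : ∀ {f A B} → Central f → (f-typed : f ∶ A ⊢ B) → StablyCoherent (mk f f-typed)
central-StablyCoherent (id-c A)  (id-t .A)    = StablyCoherent-id A
central-StablyCoherent (c-c A B) (c-t .A .B)  = StablyCoherent-cH A B
central-StablyCoherent (∘-c g f) (∘-t f-t g-t) =
  StablyCoherent-∙ (central-StablyCoherent f f-t) (central-StablyCoherent g g-t)
central-StablyCoherent (⊗-c f g) (⊗-t f-t g-t) =
  StablyCoherent-⊠ (central-StablyCoherent f f-t) (central-StablyCoherent g g-t)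

central-≈-canTm : ∀ {f A B} → Central f → f ∶ A ⊢ B → Assorted A → f ≈ canTm A B ∶ A ⊢ B
central-≈-canTm {f} {A} {B} f-central f-typed assorted = ≋⇒≈ (begin
  F                          ≋⟨ identityˡ F ⟨
  idH B ∙ F                  ≋⟨ ∙-cong (canH-identity B B∼B) ≋-refl ⟨
  canH B B B∼B ∙ F           ≋⟨ absorbed coh (Assorted⇒CountAssorted {A} assorted) B A∼B B∼B ⟩
  canH A B A∼B               ∎)
  where
  F = mk f f-typed
  coh : Coherent F
  coh = Coherent-resp-≋ (≋-sym (≋-trans (⊠-identityˡ _) (⊠-identityʳ F)))
                        (central-StablyCoherent f-central f-typed [] [])
  A∼B = preserves coh
  B∼B : SameFactors B B
  B∼B _ = refl

corollary4p16 : {A B : Form} (f g : Tm) →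
    f ∶ A ⊢ B → g ∶ A ⊢ B → Central f → Central g → Assorted A →
    f ≈ g ∶ A ⊢ B
corollary4p16 f g f-typed g-typed f-central g-central assorted =
  ≈-trans (central-≈-canTm f-central f-typed assorted)
          (≈-sym (central-≈-canTm g-central g-typed assorted))
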